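{- Fix an integer $n \ge 3$. Call a sequence $a=(a_1,\dots,a_n)\in\{1,-1\}^n$ a representative if $\sum_{i=1}^n a_i \ge 0$. A representative $a$ is equivalent to some sequence obtainable from $(1,1,1)$ by finitely many extensions if and only if (i) $a$ has at least one pair of (cyclically) adjacent equal entries, i.e. $a_i=a_{i+1}$ for some $1\le i\le n-1$ or $a_n=a_1$, and (ii) $\sum_{i=1}^n a_i \in S(n)$, where $$S(n) = \begin{cases} \{ -n,\,-n+6,\,\ldots,\,n-6,\,n\} & \text{if } n\equiv 0 \pmod 3,\\ \{ -n+4,\,-n+10,\,\ldots,\,n-10,\,n-4\} & \text{if } n\equiv 1 \pmod 3,\\ \{ -n+2,\,-n+8,\,\ldots,\,n-8,\,n-2\} & \text{if } n\equiv 2 \pmod 3,\end{cases}$$ each set consisting of the integers between its smallest and largest element in steps of $6$.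
   Context: Hexaflexagons with $n$ faces are encoded by sign sequences $(a_1,\dots,a_n)\in\{1,-1\}^n$, regarded cyclically. The trihexaflexagon has sign sequence $(1,1,1)$. An extension of a sign sequence (adding one face) replaces some single entry $a_i$ by the consecutive pair $(-a_i,-a_i)$, producing a sequence of length one greater; the entry chosen may be any entry, including $a_1$ or $a_n$. A sequence is called obtainable if it arises from $(1,1,1)$ by finitely many (possibly zero) extensions. Two sign sequences are equivalent if one can be transformed into the other by a combination of cyclic shifts $(a_1,\dots,a_n)\mapsto(a_i,a_{i+1},\dots,a_n,a_1,\dots,a_{i-1})$, reversal $(a_1,\dots,a_n)\mapsto(a_n,\dots,a_1)$, and inversion $(a_1,\dots,a_n)\mapsto(-a_1,\dots,-a_n)$. The convention is that each equivalence class is represented by a sequence with non-negative sum. -}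

module Defs where

open import Data.Nat as ℕ using (ℕ; _%_)
open import Data.Integer as ℤ using (ℤ; +_; -[1+_]; _+_; -_; _-_; _≤_)
open import Data.Sign as Sign using (Sign; opposite)
open import Data.List using (List; []; _∷_; _++_; _∷ʳ_; map; reverse)
open import Data.Product using (Σ; ∃; _×_)
open import Data.Sum using (_⊎_)
open import Relation.Binary.PropositionalEquality using (_≡_)
open import Relation.Binary.Construct.Closure.ReflexiveTransitive using (Star)

SignSeq : Set
SignSeq = List Sign

val : Sign → ℤ
val Sign.+ = + 1
val Sign.- = -[1+ 0 ]

sumSeq : SignSeq → ℤ
sumSeq []       = + 0
sumSeq (s ∷ ss) = val s + sumSeq ss

data Extension : SignSeq → SignSeq → Set where
  ext : (xs : SignSeq) (s : Sign) (ys : SignSeq) →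
        Extension (xs ++ s ∷ ys) (xs ++ opposite s ∷ opposite s ∷ ys)

data Obtainable : SignSeq → Set where
  base : Obtainable (Sign.+ ∷ Sign.+ ∷ Sign.+ ∷ [])
  step : ∀ {a b} → Obtainable a → Extension a b → Obtainable b

data Move : SignSeq → SignSeq → Set where
  shift : (x : Sign) (xs : SignSeq) → Move (x ∷ xs) (xs ∷ʳ x)
  rev   : (xs : SignSeq) → Move xs (reverse xs)
  inv   : (xs : SignSeq) → Move xs (map opposite xs)

Equivalent : SignSeq → SignSeq → Set
Equivalent = Star Move

HasAdjEqual : SignSeq → Set
HasAdjEqual a =
  (Σ SignSeq λ xs → Σ Sign λ y → Σ SignSeq λ ys → a ≡ xs ++ y ∷ y ∷ ys)
  ⊎ (Σ Sign λ y → Σ SignSeq λ xs → a ≡ y ∷ (xs ∷ʳ y))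

-- offset so that max S(n) = n - offset n
offsetMod : ℕ → ℕ
offsetMod 0 = 0
offsetMod 1 = 4
offsetMod 2 = 2
offsetMod _ = 0

offset : ℕ → ℕ
offset n = offsetMod (n % 3)

topS : ℕ → ℤ
topS n = + n - + offset n

InS : ℕ → ℤ → Set
InS n s = ∃ λ (k : ℕ) → (s ≡ - topS n + + (6 ℕ.* k)) × (s ≤ topS n)

module Submission where

-- An extension (a) ↦ (-a,-a) changes the sum by -3a, shifts and
--    reversals keep the sum, and inversion negates it.  Hence "3 divides the sum"
--    holds for (1,1,1), for every obtainable sequence and for everything equivalent
--    to one.  Every obtainable sequence has a linear pair of equal neighbours, and
--    the moves carry the cyclic-pair property (i) back to any equivalent sequence.
--  * Descent.  A sequence of length ≥ 4 with a linear pair of equal neighbours is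
--    an extension of a shorter sequence which again has such a pair.  Descending
--    to length 3, where 3 ∣ sum leaves only (1,1,1) and (-1,-1,-1), every sequence
--    with a linear pair and 3 ∣ sum is obtainable up to inversion.
--  * Arithmetic.  A sequence of length n with nonnegative sum s has n = s + 2m,
--    and for such s, n the condition s ∈ S(n) is equivalent to 3 ∣ s.

open import Defs
open import Data.Nat as ℕ using (ℕ; zero; suc; z≤n; s≤s)
import Data.Nat.Properties as ℕP
open import Data.Nat.Divisibility using (n∣m*n; m∣m*n; ∣1⇒≡1)
  renaming (_∣_ to _∣ℕ_; ∣-trans to ∣ℕ-trans; divides to dividesℕ)
open import Data.Nat.DivMod using (_%_; _/_; [m+kn]%n≡m%n; m≡m%n+[m/n]*n; m%n<n)
import Data.Nat.Tactic.RingSolver as ℕRing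
open import Data.Integer using (+_; _+_; _-_; -_; _*_; _⊖_; _≤_; +≤+; ∣_∣)
import Data.Integer.Properties as ℤP
import Data.Integer.Tactic.RingSolver as ℤRing
open import Data.Integer.Divisibility.Signed
  using (_∣_; divides; ∣m∣n⇒∣m+n; ∣m+n∣n⇒∣m; ∣m⇒∣-m; ∣ᵤ⇒∣; ∣⇒∣ᵤ)
open import Data.Sign as Sign using (Sign; opposite)
open import Data.Sign.Properties using (opposite-involutive)
open import Data.List using ([]; _∷_; _++_; _∷ʳ_; map; reverse; length; initLast; _∷ʳ′_)
import Data.List.Properties as LP
open import Data.Product using (Σ; ∃; ∃₂; _×_; _,_)
open import Data.Sum using (_⊎_; inj₁; inj₂)
open import Data.Empty using (⊥-elim)
open import Relation.Nullary using (¬_)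
open import Relation.Binary.PropositionalEquality
open import Relation.Binary.Construct.Closure.ReflexiveTransitive using (ε; _◅_; _◅◅_; fold)
open import Function.Bundles using (_⇔_; mk⇔; Equivalence)
open import Function.Construct.Composition using (_⇔-∘_)
open import Function.Construct.Identity using (⇔-id)

open Equivalence using (to; from)

val-opposite : ∀ s → val (opposite s) ≡ - val s
val-opposite Sign.+ = refl
val-opposite Sign.- = refl

sumSeq-++ : ∀ xs ys → sumSeq (xs ++ ys) ≡ sumSeq xs + sumSeq ys
sumSeq-++ []       ys = sym (ℤP.+-identityˡ (sumSeq ys))
sumSeq-++ (x ∷ xs) ys =
  trans (cong (_+_ (val x)) (sumSeq-++ xs ys)) (sym (ℤP.+-assoc (val x) (sumSeq xs) (sumSeq ys)))

sumSeq-∷ʳ : ∀ xs x → sumSeq (xs ∷ʳ x) ≡ sumSeq (x ∷ xs)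
sumSeq-∷ʳ xs x = begin
  sumSeq (xs ∷ʳ x)             ≡⟨ sumSeq-++ xs (x ∷ []) ⟩
  sumSeq xs + (val x + + 0)    ≡⟨ cong (_+_ (sumSeq xs)) (ℤP.+-identityʳ (val x)) ⟩
  sumSeq xs + val x            ≡⟨ ℤP.+-comm (sumSeq xs) (val x) ⟩
  val x + sumSeq xs            ∎
  where open ≡-Reasoning

sumSeq-reverse : ∀ xs → sumSeq (reverse xs) ≡ sumSeq xs
sumSeq-reverse []       = refl
sumSeq-reverse (x ∷ xs) = begin
  sumSeq (reverse (x ∷ xs))    ≡⟨ cong sumSeq (LP.unfold-reverse x xs) ⟩
  sumSeq (reverse xs ∷ʳ x)     ≡⟨ sumSeq-∷ʳ (reverse xs) x ⟩
  val x + sumSeq (reverse xs)  ≡⟨ cong (_+_ (val x)) (sumSeq-reverse xs) ⟩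
  val x + sumSeq xs            ∎
  where open ≡-Reasoning

sumSeq-invert : ∀ xs → sumSeq (map opposite xs) ≡ - sumSeq xs
sumSeq-invert []       = refl
sumSeq-invert (x ∷ xs) =
  trans (cong₂ _+_ (val-opposite x) (sumSeq-invert xs)) (sym (ℤP.neg-distrib-+ (val x) (sumSeq xs)))

-- Condition (ii) will turn out to be equivalent to this predicate.
SumDivisibleBy3 : SignSeq → Set
SumDivisibleBy3 w = + 3 ∣ sumSeq w

extension-sum : ∀ {v w} → Extension v w → ∃ λ d → sumSeq w ≡ sumSeq v + d * + 3
extension-sum (ext xs s ys) = o , (begin
  sumSeq (xs ++ opposite s ∷ opposite s ∷ ys) ≡⟨ sumSeq-++ xs _ ⟩
  X + (o + (o + Y))                           ≡⟨ regroup X Y o ⟩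
  X + (- o + Y) + o * + 3                     ≡⟨ cong (λ v → X + (v + Y) + o * + 3) s-value ⟩
  X + (val s + Y) + o * + 3                   ≡⟨ cong (_+ o * + 3) (sym (sumSeq-++ xs (s ∷ ys))) ⟩
  sumSeq (xs ++ s ∷ ys) + o * + 3             ∎)
  where
  open ≡-Reasoning
  o = val (opposite s)
  X = sumSeq xs
  Y = sumSeq ys
  regroup : ∀ X Y o → X + (o + (o + Y)) ≡ X + (- o + Y) + o * + 3
  regroup = ℤRing.solve-∀
  s-value : - val (opposite s) ≡ val s
  s-value = trans (sym (val-opposite (opposite s))) (cong val (opposite-involutive s))

divisible-extension : ∀ {v w} → Extension v w → SumDivisibleBy3 v ⇔ SumDivisibleBy3 w
divisible-extension e with extension-sum e
... | d , eq = mk⇔ (λ h → subst (+ 3 ∣_) (sym eq) (∣m∣n⇒∣m+n h (divides d refl)))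
                   (λ h → ∣m+n∣n⇒∣m (subst (+ 3 ∣_) eq h) (divides d refl))

move-sum : ∀ {a b} → Move a b → sumSeq b ≡ sumSeq a ⊎ sumSeq b ≡ - sumSeq a
move-sum (shift x xs) = inj₁ (sumSeq-∷ʳ xs x)
move-sum (rev xs)     = inj₁ (sumSeq-reverse xs)
move-sum (inv xs)     = inj₂ (sumSeq-invert xs)

divisible-move : ∀ {a b} → Move a b → SumDivisibleBy3 a ⇔ SumDivisibleBy3 b
divisible-move m with move-sum m
... | inj₁ eq = mk⇔ (subst (+ 3 ∣_) (sym eq)) (subst (+ 3 ∣_) eq)
... | inj₂ eq = mk⇔ (λ h → subst (+ 3 ∣_) (sym eq) (∣m⇒∣-m h))
                    (λ h → subst (+ 3 ∣_) (ℤP.neg-involutive _) (∣m⇒∣-m (subst (+ 3 ∣_) eq h)))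

divisible-equivalent : ∀ {a b} → Equivalent a b → SumDivisibleBy3 a ⇔ SumDivisibleBy3 b
divisible-equivalent = fold (λ a b → SumDivisibleBy3 a ⇔ SumDivisibleBy3 b)
                            (λ m e → e ⇔-∘ divisible-move m) (⇔-id _)

divisible-obtainable : ∀ {w} → Obtainable w → SumDivisibleBy3 w
divisible-obtainable base       = divides (+ 1) refl
divisible-obtainable (step o e) = to (divisible-extension e) (divisible-obtainable o)

length-move : ∀ {a b} → Move a b → length a ≡ length b
length-move (shift x xs) = trans (ℕP.+-comm 1 (length xs)) (sym (LP.length-++ xs))
length-move (rev xs)     = sym (LP.length-reverse xs)
length-move (inv xs)     = sym (LP.length-map opposite xs)

length-equivalent : ∀ {a b} → Equivalent a b → length a ≡ length b
length-equivalent = fold (λ a b → length a ≡ length b) (λ m e → trans (length-move m) e) refl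

LinearPair : SignSeq → Set
LinearPair w = Σ SignSeq λ xs → Σ Sign λ y → Σ SignSeq λ ys → w ≡ xs ++ y ∷ y ∷ ys

-- Every obtainable sequence contains the pair created by its last extension.
obtainable-pair : ∀ {w} → Obtainable w → LinearPair w
obtainable-pair base                   = [] , Sign.+ , Sign.+ ∷ [] , refl
obtainable-pair (step _ (ext xs s ys)) = xs , opposite s , ys , refl

invert-involutive : ∀ xs → map opposite (map opposite xs) ≡ xs
invert-involutive xs =
  trans (sym (LP.map-∘ xs)) (trans (LP.map-cong opposite-involutive xs) (LP.map-id xs))

reverse-around : ∀ xs (zs ys : SignSeq) → reverse (xs ++ zs ++ ys) ≡ reverse ys ++ reverse zs ++ reverse xs
reverse-around xs zs ys = begin
  reverse (xs ++ zs ++ ys)                 ≡⟨ LP.reverse-++ xs (zs ++ ys) ⟩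
  reverse (zs ++ ys) ++ reverse xs         ≡⟨ cong (_++ reverse xs) (LP.reverse-++ zs ys) ⟩
  (reverse ys ++ reverse zs) ++ reverse xs ≡⟨ LP.++-assoc (reverse ys) (reverse zs) (reverse xs) ⟩
  reverse ys ++ reverse zs ++ reverse xs   ∎
  where open ≡-Reasoning

adjacent-reverse : ∀ {w} → HasAdjEqual w → HasAdjEqual (reverse w)
adjacent-reverse (inj₁ (xs , y , ys , refl)) = inj₁ (reverse ys , y , reverse xs , reverse-around xs (y ∷ y ∷ []) ys)
adjacent-reverse (inj₂ (y , xs , refl))      = inj₂ (y , reverse xs , reverse-around (y ∷ []) xs (y ∷ []))

adjacent-invert : ∀ {w} → HasAdjEqual w → HasAdjEqual (map opposite w)
adjacent-invert (inj₁ (xs , y , ys , refl)) =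
  inj₁ (map opposite xs , opposite y , map opposite ys , LP.map-++ opposite xs (y ∷ y ∷ ys))
adjacent-invert (inj₂ (y , xs , refl)) =
  inj₂ (opposite y , map opposite xs , cong (opposite y ∷_) (LP.map-++ opposite xs (y ∷ [])))

-- Undoing a shift: a pair of xs ∷ʳ x lies inside xs, or is the final pair, which
-- wraps around in x ∷ xs, or is the wrap-around pair, which leads x ∷ xs.
adjacent-unshift : ∀ x xs → HasAdjEqual (xs ∷ʳ x) → HasAdjEqual (x ∷ xs)
adjacent-unshift x xs (inj₂ (y , ys , eq)) with LP.∷ʳ-injective xs (y ∷ ys) eq
... | refl , refl = inj₁ ([] , y , ys , refl)
adjacent-unshift x xs (inj₁ (ys , y , zs , eq)) with initLast zs
... | [] with LP.∷ʳ-injective xs (ys ∷ʳ y) (trans eq (sym (LP.∷ʳ-++ ys y (y ∷ []))))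
...   | refl , refl = inj₂ (y , ys , refl)
adjacent-unshift x xs (inj₁ (ys , y , zs , eq)) | zs′ ∷ʳ′ z
  with LP.∷ʳ-injective xs (ys ++ y ∷ y ∷ zs′) (trans eq (sym (LP.++-assoc ys (y ∷ y ∷ zs′) (z ∷ []))))
... | refl , refl = inj₁ (x ∷ ys , y , zs′ , refl)

adjacent-move : ∀ {a b} → Move a b → HasAdjEqual b → HasAdjEqual a
adjacent-move (shift x xs) h = adjacent-unshift x xs h
adjacent-move (rev xs)     h = subst HasAdjEqual (LP.reverse-involutive xs) (adjacent-reverse h)
adjacent-move (inv xs)     h = subst HasAdjEqual (invert-involutive xs) (adjacent-invert h)

adjacent-equivalent : ∀ {a b} → Equivalent a b → HasAdjEqual b → HasAdjEqual a
adjacent-equivalent = fold (λ a b → HasAdjEqual b → HasAdjEqual a) (λ m f h → adjacent-move m (f h)) (λ h → h)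

-- Rotating a wrap-around pair to the end makes it linear.
linearise : ∀ {a} → HasAdjEqual a → Σ SignSeq λ a′ → Equivalent a a′ × LinearPair a′
linearise (inj₁ pair)           = _ , ε , pair
linearise (inj₂ (y , xs , refl)) =
  (xs ∷ʳ y) ∷ʳ y , shift y (xs ∷ʳ y) ◅ ε , xs , y , [] , LP.∷ʳ-++ xs y (y ∷ [])

same-or-opposite : ∀ s t → t ≡ s ⊎ t ≡ opposite s
same-or-opposite Sign.+ Sign.+ = inj₁ refl
same-or-opposite Sign.+ Sign.- = inj₂ refl
same-or-opposite Sign.- Sign.+ = inj₂ refl
same-or-opposite Sign.- Sign.- = inj₁ refl

contraction : ∀ xs s ys → Extension (xs ++ opposite s ∷ ys) (xs ++ s ∷ s ∷ ys)
contraction xs s ys =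
  subst (λ t → Extension (xs ++ opposite s ∷ ys) (xs ++ t ∷ t ∷ ys)) (opposite-involutive s) (ext xs (opposite s) ys)

Contractible : SignSeq → Set
Contractible w = Σ SignSeq λ v → Extension v w × LinearPair v

contract-before-opposite : ∀ xs s ys → Contractible (xs ++ s ∷ s ∷ opposite s ∷ ys)
contract-before-opposite xs s ys =
  xs ++ opposite s ∷ opposite s ∷ ys , contraction xs s (opposite s ∷ ys) , xs , opposite s , ys , refl

contract-after-opposite : ∀ xs s ys → Contractible (xs ++ opposite s ∷ s ∷ s ∷ ys)
contract-after-opposite xs s ys = subst Contractible (LP.∷ʳ-++ xs (opposite s) (s ∷ s ∷ ys))
  ((xs ∷ʳ opposite s) ++ opposite s ∷ ys , contraction (xs ∷ʳ opposite s) s ys ,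
   xs , opposite s , ys , LP.∷ʳ-++ xs (opposite s) (opposite s ∷ ys))

contract-before-pair : ∀ xs s ys → Contractible (xs ++ s ∷ s ∷ s ∷ s ∷ ys)
contract-before-pair xs s ys =
  xs ++ opposite s ∷ s ∷ s ∷ ys , contraction xs s (s ∷ s ∷ ys) ,
  xs ∷ʳ opposite s , s , ys , sym (LP.∷ʳ-++ xs (opposite s) (s ∷ s ∷ ys))

contract-end-triple : ∀ xs x s → Contractible (xs ++ x ∷ s ∷ s ∷ s ∷ [])
contract-end-triple xs x s with same-or-opposite s x
... | inj₁ refl = contract-before-pair xs s []
... | inj₂ refl = contract-after-opposite xs s (s ∷ [])

contract-end-pair : ∀ xs x y s → Contractible (xs ++ x ∷ y ∷ s ∷ s ∷ [])
contract-end-pair xs x y s with same-or-opposite s y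
... | inj₁ refl = contract-end-triple xs x s
... | inj₂ refl = subst Contractible (LP.∷ʳ-++ xs x _) (contract-after-opposite (xs ∷ʳ x) s [])

-- Look right of
-- the pair: an opposite sign or a second pair is handled directly and s s s -s by
-- moving one step right; if fewer than two signs follow, the length bound
-- provides the signs to the left needed by the end cases.
contract : ∀ xs s ys → 4 ℕ.≤ length (xs ++ s ∷ s ∷ ys) → Contractible (xs ++ s ∷ s ∷ ys)
contract xs s (t ∷ ys) long with same-or-opposite s t
contract xs s (t ∷ ys) long | inj₂ refl = contract-before-opposite xs s ys
contract xs s (t ∷ t′ ∷ ys) long | inj₁ refl with same-or-opposite s t′
... | inj₁ refl = contract-before-pair xs s ys
... | inj₂ refl = subst Contractible (LP.∷ʳ-++ xs s _) (contract-before-opposite (xs ∷ʳ s) s ys)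
contract xs s (t ∷ []) long | inj₁ refl with initLast xs
contract .[] s (t ∷ []) (s≤s (s≤s (s≤s ()))) | inj₁ refl | []
... | xs′ ∷ʳ′ x = subst Contractible (sym (LP.∷ʳ-++ xs′ x _)) (contract-end-triple xs′ x s)
contract xs s [] long with initLast xs
contract .[] s [] (s≤s (s≤s ())) | []
... | xs′ ∷ʳ′ x with initLast xs′
contract .([] ∷ʳ x) s [] (s≤s (s≤s (s≤s ()))) | .[] ∷ʳ′ x | []
... | xs″ ∷ʳ′ x′ = subst Contractible (sym (trans (LP.∷ʳ-++ (xs″ ∷ʳ x′) x _) (LP.∷ʳ-++ xs″ x′ _)))
                         (contract-end-pair xs″ x′ x s)

extension-length : ∀ {v w} → Extension v w → length w ≡ suc (length v)
extension-length (ext xs s ys) = begin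
  length (xs ++ opposite s ∷ opposite s ∷ ys) ≡⟨ LP.length-++ xs ⟩
  length xs ℕ.+ suc (suc (length ys))         ≡⟨ ℕP.+-suc (length xs) _ ⟩
  suc (length xs ℕ.+ suc (length ys))         ≡⟨ cong suc (LP.length-++ xs) ⟨
  suc (length (xs ++ s ∷ ys))                 ∎
  where open ≡-Reasoning

invert-extension : ∀ {v w} → Extension v w → Extension (map opposite v) (map opposite w)
invert-extension (ext xs s ys) =
  subst₂ Extension (sym (LP.map-++ opposite xs (s ∷ ys)))
                   (sym (LP.map-++ opposite xs (opposite s ∷ opposite s ∷ ys)))
                   (ext (map opposite xs) (opposite s) (map opposite ys))

-- The descent ends at (1,1,1) or at its inversion (-1,-1,-1).
ObtainableUpToInversion : SignSeq → Set
ObtainableUpToInversion w = Obtainable w ⊎ Obtainable (map opposite w)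

not-divisible-unit : ∀ {i} → ∣ i ∣ ≡ 1 → ¬ (+ 3 ∣ i)
not-divisible-unit abs-one d with ∣1⇒≡1 (subst (3 ∣ℕ_) abs-one (∣⇒∣ᵤ d))
... | ()

length-three : ∀ w → length w ≡ 3 → SumDivisibleBy3 w → ObtainableUpToInversion w
length-three (Sign.+ ∷ Sign.+ ∷ Sign.+ ∷ []) _ _ = inj₁ base
length-three (Sign.- ∷ Sign.- ∷ Sign.- ∷ []) _ _ = inj₂ base
length-three (Sign.+ ∷ Sign.+ ∷ Sign.- ∷ []) _ d = ⊥-elim (not-divisible-unit refl d)
length-three (Sign.+ ∷ Sign.- ∷ Sign.+ ∷ []) _ d = ⊥-elim (not-divisible-unit refl d)
length-three (Sign.- ∷ Sign.+ ∷ Sign.+ ∷ []) _ d = ⊥-elim (not-divisible-unit refl d)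
length-three (Sign.+ ∷ Sign.- ∷ Sign.- ∷ []) _ d = ⊥-elim (not-divisible-unit refl d)
length-three (Sign.- ∷ Sign.+ ∷ Sign.- ∷ []) _ d = ⊥-elim (not-divisible-unit refl d)
length-three (Sign.- ∷ Sign.- ∷ Sign.+ ∷ []) _ d = ⊥-elim (not-divisible-unit refl d)

descend : ∀ k w → length w ≡ 3 ℕ.+ k → LinearPair w → SumDivisibleBy3 w → ObtainableUpToInversion w
descend zero    w len _                  d = length-three w len d
descend (suc k) w len (xs , s , ys , refl) d
  with contract xs s ys (subst (4 ℕ.≤_) (sym len) (ℕP.m≤m+n 4 k))
... | v , e , pair = extend (descend k v shorter pair (from (divisible-extension e) d))
  where
  shorter : length v ≡ 3 ℕ.+ k
  shorter = ℕP.suc-injective (trans (sym (extension-length e)) len)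
  extend : ObtainableUpToInversion v → ObtainableUpToInversion (xs ++ s ∷ s ∷ ys)
  extend (inj₁ o) = inj₁ (step o e)
  extend (inj₂ o) = inj₂ (step o (invert-extension e))

necessary : ∀ {a b} → Obtainable b → Equivalent a b → HasAdjEqual a × SumDivisibleBy3 a
necessary ob a~b =
  adjacent-equivalent a~b (inj₁ (obtainable-pair ob)) , from (divisible-equivalent a~b) (divisible-obtainable ob)

sufficient : ∀ k a → length a ≡ 3 ℕ.+ k → HasAdjEqual a → SumDivisibleBy3 a →
             Σ SignSeq λ b → Obtainable b × Equivalent a b
sufficient k a len adj d with linearise adj
... | a′ , a~a′ , pair with descend k a′ (trans (sym (length-equivalent a~a′)) len) pair
                                   (to (divisible-equivalent a~a′) d)
...   | inj₁ o = a′ , o , a~a′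
...   | inj₂ o = map opposite a′ , o , a~a′ ◅◅ inv a′ ◅ ε

⊖-cancel : ∀ m n → (m ℕ.+ n) ⊖ m ≡ + n
⊖-cancel m n = trans (ℤP.⊖-≥ (ℕP.m≤m+n m n)) (cong +_ (ℕP.m+n∸m≡n m n))

-- Writing n = 2r + 3K with r < 3, the offset of n is exactly 2r.
offset-double : ∀ r → r ℕ.< 3 → offsetMod ((2 ℕ.* r) % 3) ≡ 2 ℕ.* r
offset-double 0 _ = refl
offset-double 1 _ = refl
offset-double 2 _ = refl
offset-double (suc (suc (suc _))) (s≤s (s≤s (s≤s ())))

topS-normal : ∀ r K → r ℕ.< 3 → topS (2 ℕ.* r ℕ.+ K ℕ.* 3) ≡ + (K ℕ.* 3)
topS-normal r K r<3 = begin
  + n - + offsetMod (n % 3)             ≡⟨ cong (λ i → + n - + offsetMod i) ([m+kn]%n≡m%n (2 ℕ.* r) K 3) ⟩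
  + n - + offsetMod ((2 ℕ.* r) % 3)     ≡⟨ cong (λ i → + n - + i) (offset-double r r<3) ⟩
  + n - + (2 ℕ.* r)                     ≡⟨ ℤP.[+m]-[+n]≡m⊖n n (2 ℕ.* r) ⟩
  n ⊖ (2 ℕ.* r)                         ≡⟨ ⊖-cancel (2 ℕ.* r) (K ℕ.* 3) ⟩
  + (K ℕ.* 3)                           ∎
  where
  open ≡-Reasoning
  n = 2 ℕ.* r ℕ.+ K ℕ.* 3

normal-form : ∀ j → ∃₂ λ r K → r ℕ.< 3 × 3 ℕ.+ j ≡ 2 ℕ.* r ℕ.+ K ℕ.* 3
normal-form 0 = 0 , 1 , s≤s z≤n , refl
normal-form 1 = 2 , 0 , s≤s (s≤s (s≤s z≤n)) , refl
normal-form 2 = 1 , 1 , s≤s (s≤s z≤n) , refl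
normal-form (suc (suc (suc j))) with normal-form j
... | r , K , r<3 , eq = r , suc K , r<3 , trans (cong (3 ℕ.+_) eq) (regroup (2 ℕ.* r) (K ℕ.* 3))
  where
  regroup : ∀ a b → 3 ℕ.+ (a ℕ.+ b) ≡ a ℕ.+ (3 ℕ.+ b)
  regroup = ℕRing.solve-∀

-- Hence the largest element of S(n) is a multiple of 3 and so is every element.
inS-divisible : ∀ n i → 3 ℕ.≤ n → InS n i → + 3 ∣ i
inS-divisible n i n≥3 (k , i≡ , _) with ℕP.m≤n⇒∃[o]m+o≡n n≥3
... | j , 3+j≡n with normal-form j
...   | r , K , r<3 , eq =
  subst (+ 3 ∣_) (sym i≡) (∣m∣n⇒∣m+n (∣m⇒∣-m (subst (+ 3 ∣_) (sym top) (∣ᵤ⇒∣ (n∣m*n K))))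
                                      (∣ᵤ⇒∣ (∣ℕ-trans (n∣m*n 2) (m∣m*n k))))
  where
  top : topS n ≡ + (K ℕ.* 3)
  top = trans (cong topS (trans (sym 3+j≡n) eq)) (topS-normal r K r<3)

inS-multiple : ∀ t m → InS (t ℕ.* 3 ℕ.+ 2 ℕ.* m) (+ (t ℕ.* 3))
inS-multiple t m = t ℕ.+ q , value , bound
  where
  open ≡-Reasoning
  r = m % 3
  q = m / 3
  K = t ℕ.+ 2 ℕ.* q
  n = t ℕ.* 3 ℕ.+ 2 ℕ.* m
  normal : ∀ t r q → t ℕ.* 3 ℕ.+ 2 ℕ.* (r ℕ.+ q ℕ.* 3) ≡ 2 ℕ.* r ℕ.+ (t ℕ.+ 2 ℕ.* q) ℕ.* 3
  normal = ℕRing.solve-∀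
  six : ∀ t q → 6 ℕ.* (t ℕ.+ q) ≡ (t ℕ.+ 2 ℕ.* q) ℕ.* 3 ℕ.+ t ℕ.* 3
  six = ℕRing.solve-∀
  top : topS n ≡ + (K ℕ.* 3)
  top = trans (cong (λ x → topS (t ℕ.* 3 ℕ.+ 2 ℕ.* x)) (m≡m%n+[m/n]*n m 3))
              (trans (cong topS (normal t r q)) (topS-normal r K (m%n<n m 3)))
  value : + (t ℕ.* 3) ≡ - topS n + + (6 ℕ.* (t ℕ.+ q))
  value = sym (begin
    - topS n + + (6 ℕ.* (t ℕ.+ q))       ≡⟨ cong (λ x → - x + + (6 ℕ.* (t ℕ.+ q))) top ⟩
    - + (K ℕ.* 3) + + (6 ℕ.* (t ℕ.+ q))  ≡⟨ ℤP.-m+n≡n⊖m (K ℕ.* 3) _ ⟩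
    (6 ℕ.* (t ℕ.+ q)) ⊖ (K ℕ.* 3)        ≡⟨ cong (_⊖ (K ℕ.* 3)) (six t q) ⟩
    (K ℕ.* 3 ℕ.+ t ℕ.* 3) ⊖ (K ℕ.* 3)    ≡⟨ ⊖-cancel (K ℕ.* 3) (t ℕ.* 3) ⟩
    + (t ℕ.* 3)                          ∎)
  bound : + (t ℕ.* 3) ≤ topS n
  bound = subst (+ (t ℕ.* 3) ≤_) (sym top) (+≤+ (ℕP.*-monoˡ-≤ 3 (ℕP.m≤m+n t (2 ℕ.* q))))

minuses : SignSeq → ℕ
minuses []           = 0
minuses (Sign.+ ∷ w) = minuses w
minuses (Sign.- ∷ w) = suc (minuses w)

length-from-sum : ∀ w → sumSeq w + + minuses w + + minuses w ≡ + length w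
length-from-sum []           = refl
length-from-sum (Sign.+ ∷ w) = trans (regroup (sumSeq w) (+ minuses w)) (cong (_+_ (+ 1)) (length-from-sum w))
  where
  regroup : ∀ S M → + 1 + S + M + M ≡ + 1 + (S + M + M)
  regroup = ℤRing.solve-∀
length-from-sum (Sign.- ∷ w) = trans (regroup (sumSeq w) (+ minuses w)) (cong (_+_ (+ 1)) (length-from-sum w))
  where
  regroup : ∀ S M → - + 1 + S + (+ 1 + M) + (+ 1 + M) ≡ + 1 + (S + M + M)
  regroup = ℤRing.solve-∀

nonnegative-sum : ∀ w → + 0 ≤ sumSeq w → ∃₂ λ s m → sumSeq w ≡ + s × length w ≡ s ℕ.+ 2 ℕ.* m
nonnegative-sum w nonneg with sumSeq w | nonneg | length-from-sum w
... | + s | _ | eq = s , minuses w , refl , trans (sym (ℤP.+-injective eq)) (double s (minuses w))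
  where
  double : ∀ s m → s ℕ.+ m ℕ.+ m ≡ s ℕ.+ 2 ℕ.* m
  double = ℕRing.solve-∀

inS-iff-divisible : ∀ n w → 3 ℕ.≤ n → length w ≡ n → + 0 ≤ sumSeq w →
                    InS n (sumSeq w) ⇔ SumDivisibleBy3 w
inS-iff-divisible n w n≥3 len nonneg with nonnegative-sum w nonneg
... | s , m , sum≡s , len≡ = mk⇔ (inS-divisible n (sumSeq w) n≥3) divisible⇒inS
  where
  divisible⇒inS : SumDivisibleBy3 w → InS n (sumSeq w)
  divisible⇒inS d with ∣⇒∣ᵤ (subst (+ 3 ∣_) sum≡s d)
  ... | dividesℕ t s≡t*3 =
    subst₂ InS (trans (cong (ℕ._+ 2 ℕ.* m) (sym s≡t*3)) (trans (sym len≡) len))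
               (trans (cong +_ (sym s≡t*3)) (sym sum≡s))
               (inS-multiple t m)

mainTheorem1 : (n : ℕ) → 3 ℕ.≤ n → (a : SignSeq) → length a ≡ n →
    _≤_ (+ 0) (sumSeq a) →
    (Σ SignSeq (λ b → Obtainable b × Equivalent a b)) ⇔ (HasAdjEqual a × InS n (sumSeq a))
mainTheorem1 n n≥3 a len nonneg = mk⇔ only-if if
  where
  inS⇔divisible : InS n (sumSeq a) ⇔ SumDivisibleBy3 a
  inS⇔divisible = inS-iff-divisible n a n≥3 len nonneg
  only-if : Σ SignSeq (λ b → Obtainable b × Equivalent a b) → HasAdjEqual a × InS n (sumSeq a)
  only-if (b , ob , a~b) with necessary ob a~b
  ... | adj , d = adj , from inS⇔divisible d
  if : HasAdjEqual a × InS n (sumSeq a) → Σ SignSeq (λ b → Obtainable b × Equivalent a b)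
  if (adj , ins) with ℕP.m≤n⇒∃[o]m+o≡n n≥3
  ... | k , 3+k≡n = sufficient k a (trans len (sym 3+k≡n)) adj (to inS⇔divisible ins)
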